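{- Let $\alpha<\beta<\gamma$ be distinct primes, let $G=\langle a\rangle$ be a cyclic group of order $\alpha^2\beta^2\gamma^2$, and let $C=\{x\in G : |x|\in\{\alpha^2,\beta^2,\gamma^2\}\}$. Let $Cay_{p^2}(G,C)$ be the simple undirected graph with vertex set $G$ in which two distinct vertices $x,y$ are adjacent if and only if $xy^{ -1}\in C$. Then the clique number of $Cay_{p^2}(G,C)$ is $\gamma$.
   Context: $|x|$ denotes the order of the element $x$ in $G$. The clique number is the maximum size of a set of pairwise adjacent vertices. -}

module Defs where

open import Data.Nat using (ℕ; _+_; _*_; _∸_; _≤_; NonZero)
open import Data.Nat.DivMod using (_mod_)
open import Data.Nat.Divisibility using (_∣_)
open import Data.Fin using (Fin; toℕ)
open import Data.Product using (Σ; _×_)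
open import Data.Sum using (_⊎_)
open import Relation.Binary.PropositionalEquality using (_≡_; _≢_)
open import Function.Definitions using (Injective)

-- The cyclic group of order n, G = ⟨a⟩, is modelled as ℤ/nℤ with carrier Fin n,
-- the element a^i being represented by i (a ↦ 1).  Group operation is addition mod n,
-- so x y⁻¹ corresponds to x - y mod n.
_⊖_ : {n : ℕ} .{{_ : NonZero n}} → Fin n → Fin n → Fin n
_⊖_ {n} x y = (toℕ x + (n ∸ toℕ y)) mod n

HasOrder : (n : ℕ) → Fin n → ℕ → Set
HasOrder n x k =
  (1 ≤ k) × (n ∣ k * toℕ x) × (∀ j → 1 ≤ j → n ∣ j * toℕ x → k ≤ j)

InC : (n α β γ : ℕ) → Fin n → Set
InC n α β γ x = HasOrder n x (α * α) ⊎ HasOrder n x (β * β) ⊎ HasOrder n x (γ * γ)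

Adj : (n α β γ : ℕ) .{{_ : NonZero n}} → Fin n → Fin n → Set
Adj n α β γ x y = (x ≢ y) × InC n α β γ (x ⊖ y)

IsClique : (n α β γ : ℕ) .{{_ : NonZero n}} → (k : ℕ) → (Fin k → Fin n) → Set
IsClique n α β γ k f =
  Injective _≡_ _≡_ f × (∀ i j → i ≢ j → Adj n α β γ (f i) (f j))

CliqueNumberIs : (n α β γ : ℕ) .{{_ : NonZero n}} → ℕ → Set
CliqueNumberIs n α β γ ω =
  Σ (Fin ω → Fin n) (IsClique n α β γ ω)
  × (∀ k (f : Fin k → Fin n) → IsClique n α β γ k f → k ≤ ω)

{-# OPTIONS --safe #-}
-- Read a vertex x of ℤ/n through its residues modulo α, β and γ.  If n = p²M, an element has order
-- p² exactly when it is a multiple of M but not of pM; so when p ∤ M and x − y has order p², the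
-- vertices x and y agree modulo the primes dividing M and differ modulo p.  Adjacent vertices
-- thus differ in exactly one of the three residues, and a clique for that relation lies on a line:
-- all its vertices share two residues, so its size is at most the remaining prime, hence at most γ.
-- Conversely the γ multiples of α²β² below n differ pairwise by elements of order γ².
module Submission where

open import Defs
open import Data.Nat using (ℕ; zero; suc; _+_; _*_; _∸_; _≤_; _<_; _%_; z≤n; NonZero; >-nonZero; >-nonZero⁻¹; nonTrivial⇒n>1)
open import Data.Nat.Properties
open import Data.Nat.DivMod using (_mod_; %-distribˡ-+; %-remove-+ˡ; %-remove-+ʳ; m*n%n≡0; m<n⇒m%n≡m)
open import Data.Nat.Divisibility
open import Algebra.Properties.CommutativeSemigroup *-commutativeSemigroup
  using (xy∙z≈xz∙y; xy∙z≈y∙xz; x∙yz≈y∙xz)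
open import Data.Nat.Primality using (Prime; prime⇒nonZero; prime⇒nonTrivial; prime⇒irreducible; euclidsLemma)
open import Data.Fin using (Fin; zero; suc; toℕ; fromℕ<)
open import Data.Fin.Properties using (toℕ-fromℕ<; toℕ-injective; toℕ<n; injective⇒≤)
import Data.Fin.Properties as Fin
open import Data.Product using (Σ; ∃-syntax; _×_; _,_; proj₁; proj₂)
open import Data.Sum using (inj₁; inj₂; [_,_]′)
open import Data.Empty using (⊥-elim)
open import Function using (_∘_; id; _⇔_; mk⇔; Equivalence)
open import Function.Definitions using (Injective)
open import Relation.Nullary using (¬_; yes; no)
open import Relation.Binary.Definitions using (DecidableEquality)
open import Relation.Binary.PropositionalEquality
  using (_≡_; _≢_; ≢-sym; refl; sym; trans; cong; subst; module ≡-Reasoning)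

open import Function.Properties.Equivalence using () renaming (trans to ⇔-trans)

open Equivalence using (to; from)

prime⇒1<p : ∀ {p} → Prime p → 1 < p
prime⇒1<p {p} pp = nonTrivial⇒n>1 p {{prime⇒nonTrivial pp}}

∣+⇔%≡ : ∀ {q} .{{_ : NonZero q}} a b c → q ∣ b + c → (q ∣ a + c ⇔ a % q ≡ b % q)
∣+⇔%≡ {q} a b c q∣b+c = mk⇔ %≡ ∣+
  where
  open ≡-Reasoning
  %≡ : q ∣ a + c → a % q ≡ b % q
  %≡ q∣a+c = begin
    a % q             ≡⟨ %-remove-+ʳ a q∣b+c ⟨
    (a + (b + c)) % q ≡⟨ cong (_% q) (trans (cong (a +_) (+-comm b c)) (sym (+-assoc a c b))) ⟩
    (a + c + b) % q   ≡⟨ %-remove-+ˡ b q∣a+c ⟩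
    b % q             ∎
  ∣+ : a % q ≡ b % q → q ∣ a + c
  ∣+ a≡b = m%n≡0⇒n∣m (a + c) q (begin
    (a + c) % q         ≡⟨ %-distribˡ-+ a c q ⟩
    (a % q + c % q) % q ≡⟨ cong (λ r → (r + c % q) % q) a≡b ⟩
    (b % q + c % q) % q ≡⟨ %-distribˡ-+ b c q ⟨
    (b + c) % q         ≡⟨ n∣m⇒m%n≡0 (b + c) q q∣b+c ⟩
    0                   ∎)

∣%⇔∣ : ∀ {q n} .{{_ : NonZero n}} → q ∣ n → (m : ℕ) → q ∣ m % n ⇔ q ∣ m
∣%⇔∣ q∣n m = mk⇔ (∣n∣m%n⇒∣m q∣n) (λ q∣m → %-presˡ-∣ q∣m q∣n)

∣⊖⇔%≡ : ∀ {n q} .{{_ : NonZero n}} .{{_ : NonZero q}} → q ∣ n → (x y : Fin n) →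
        q ∣ toℕ (x ⊖ y) ⇔ toℕ x % q ≡ toℕ y % q
∣⊖⇔%≡ {n} {q} q∣n x y = subst (λ d → q ∣ d ⇔ toℕ x % q ≡ toℕ y % q) (sym (toℕ-fromℕ< _))
  (⇔-trans (∣%⇔∣ q∣n _) (∣+⇔%≡ (toℕ x) (toℕ y) (n ∸ toℕ y) (subst (q ∣_) (sym y+[n∸y]≡n) q∣n)))
  where
  y+[n∸y]≡n : toℕ y + (n ∸ toℕ y) ≡ n
  y+[n∸y]≡n = m+[n∸m]≡n (<⇒≤ (toℕ<n y))

prime∣m*n⇒∣m : ∀ {p m n} → Prime p → ¬ p ∣ n → p ∣ m * n → p ∣ m
prime∣m*n⇒∣m {m = m} {n} pp p∤n p∣mn = [ id , ⊥-elim ∘ p∤n ]′ (euclidsLemma m n pp p∣mn)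

prime²∣m*n⇒∣m : ∀ {p m n} → Prime p → ¬ p ∣ n → p * p ∣ m * n → p * p ∣ m
prime²∣m*n⇒∣m {p} {m} {n} pp p∤n p²∣mn with prime∣m*n⇒∣m pp p∤n (∣-trans (m∣m*n p) p²∣mn)
... | divides m′ m≡m′p = subst (p * p ∣_) (sym m≡m′p) (*-monoˡ-∣ p p∣m′)
  where
  instance _ = prime⇒nonZero pp
  mn≡m′n*p : m * n ≡ m′ * n * p
  mn≡m′n*p = trans (cong (_* n) m≡m′p) (xy∙z≈xz∙y m′ p n)
  p∣m′ : p ∣ m′
  p∣m′ = prime∣m*n⇒∣m pp p∤n (*-cancelʳ-∣ p (subst (p * p ∣_) mn≡m′n*p p²∣mn))

prime∤* : ∀ {p m n} → Prime p → ¬ p ∣ m → ¬ p ∣ n → ¬ p ∣ m * n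
prime∤* {m = m} {n} pp p∤m p∤n p∣mn = [ p∤m , p∤n ]′ (euclidsLemma m n pp p∣mn)

prime∤prime : ∀ {p q} → Prime p → Prime q → p ≢ q → ¬ p ∣ q
prime∤prime pp pq p≢q p∣q =
  [ (<⇒≢ (prime⇒1<p pp)) ∘ sym , p≢q ]′ (prime⇒irreducible pq p∣q)

prime∤q²r² : ∀ {p q r} → Prime p → ¬ p ∣ q → ¬ p ∣ r → ¬ p ∣ q * q * (r * r)
prime∤q²r² pp p∤q p∤r = prime∤* pp (prime∤* pp p∤q p∤q) (prime∤* pp p∤r p∤r)

q∣q²r² : ∀ q r → q ∣ q * q * (r * r)
q∣q²r² q r = ∣-trans (m∣m*n q) (m∣m*n (r * r))

r∣q²r² : ∀ q r → r ∣ q * q * (r * r)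
r∣q²r² q r = ∣-trans (m∣m*n r) (n∣m*n (q * q))

%-injective⇒≤ : ∀ {k} q .{{_ : NonZero q}} (g : Fin k → ℕ) → Injective _≡_ _≡_ (λ i → g i % q) → k ≤ q
%-injective⇒≤ q g inj = injective⇒≤ {f = λ i → g i mod q}
  (λ eq → inj (trans (sym (toℕ-fromℕ< _)) (trans (cong toℕ eq) (toℕ-fromℕ< _))))

hasOrder-p²⇒ : ∀ {p M n} → Prime p → n ≡ p * p * M → (x : Fin n) →
               HasOrder n x (p * p) → M ∣ toℕ x × ¬ p * M ∣ toℕ x
hasOrder-p²⇒ {p} {M} {n} pp n≡p²M x (_ , n∣p²x , minimal) = M∣x , pM∤x
  where
  instance
    p≢0 : NonZero p
    p≢0 = prime⇒nonZero pp
  M∣x : M ∣ toℕ x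
  M∣x = *-cancelˡ-∣ (p * p) {{m*n≢0 p p}} (subst (_∣ p * p * toℕ x) n≡p²M n∣p²x)
  pM∤x : ¬ p * M ∣ toℕ x
  pM∤x pM∣x = <⇒≱ (m<m*n p p (prime⇒1<p pp)) (minimal p (>-nonZero⁻¹ p) n∣px)
    where
    n∣px : n ∣ p * toℕ x
    n∣px = subst (_∣ p * toℕ x) (sym (trans n≡p²M (*-assoc p p M))) (*-monoʳ-∣ p pM∣x)

hasOrder-p²⇐ : ∀ {p M n} .{{_ : NonZero M}} → Prime p → n ≡ p * p * M → (x : Fin n) →
               M ∣ toℕ x → ¬ p * M ∣ toℕ x → HasOrder n x (p * p)
hasOrder-p²⇐ {p} {M} {n} pp n≡p²M x (divides e x≡eM) pM∤x =
  >-nonZero⁻¹ (p * p) , divides e p²x≡en , minimal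
  where
  open ≡-Reasoning
  instance
    p²≢0 : NonZero (p * p)
    p²≢0 = m*n≢0 p p {{prime⇒nonZero pp}} {{prime⇒nonZero pp}}
  p∤e : ¬ p ∣ e
  p∤e p∣e = pM∤x (subst (p * M ∣_) (sym x≡eM) (*-monoˡ-∣ M p∣e))
  p²x≡en : p * p * toℕ x ≡ e * n
  p²x≡en = begin
    p * p * toℕ x   ≡⟨ cong (p * p *_) x≡eM ⟩
    p * p * (e * M) ≡⟨ x∙yz≈y∙xz (p * p) e M ⟩
    e * (p * p * M) ≡⟨ cong (e *_) n≡p²M ⟨
    e * n           ∎
  minimal : ∀ j → 1 ≤ j → n ∣ j * toℕ x → p * p ≤ j
  minimal j 1≤j (divides t jx≡tn) =
    ∣⇒≤ {{>-nonZero 1≤j}} (prime²∣m*n⇒∣m pp p∤e (divides t je≡tp²))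
    where
    je≡tp² : j * e ≡ t * (p * p)
    je≡tp² = *-cancelʳ-≡ (j * e) (t * (p * p)) M (begin
      j * e * M       ≡⟨ *-assoc j e M ⟩
      j * (e * M)     ≡⟨ cong (j *_) x≡eM ⟨
      j * toℕ x       ≡⟨ jx≡tn ⟩
      t * n           ≡⟨ cong (t *_) n≡p²M ⟩
      t * (p * p * M) ≡⟨ *-assoc t (p * p) M ⟨
      t * (p * p) * M ∎)

hasOrder-p²⇒∤ : ∀ {p M n} → Prime p → ¬ p ∣ M → n ≡ p * p * M → (x : Fin n) →
                HasOrder n x (p * p) → M ∣ toℕ x × ¬ p ∣ toℕ x
hasOrder-p²⇒∤ {p} {M} pp p∤M n≡p²M x order with hasOrder-p²⇒ pp n≡p²M x order
... | M∣x@(divides e x≡eM) , pM∤x = M∣x , p∤x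
  where
  p∤x : ¬ p ∣ toℕ x
  p∤x p∣x = pM∤x (subst (p * M ∣_) (sym x≡eM)
    (*-monoˡ-∣ M (prime∣m*n⇒∣m {m = e} pp p∤M (subst (p ∣_) x≡eM p∣x))))

module Multiples {p M n} .{{_ : NonZero M}} .{{_ : NonZero n}} (pp : Prime p) (n≡p²M : n ≡ p * p * M) where

  instance
    p≢0 : NonZero p
    p≢0 = prime⇒nonZero pp
    pM≢0 : NonZero (p * M)
    pM≢0 = m*n≢0 p M

  n≡p*pM : n ≡ p * (p * M)
  n≡p*pM = trans n≡p²M (*-assoc p p M)

  iM<pM : (i : Fin p) → toℕ i * M < p * M
  iM<pM i = *-monoˡ-< M (toℕ<n i)

  multiple : Fin p → Fin n
  multiple i = fromℕ< (<-≤-trans (iM<pM i) (subst (p * M ≤_) (sym n≡p*pM) (m≤n*m (p * M) p)))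

  toℕ-multiple : ∀ i → toℕ (multiple i) ≡ toℕ i * M
  toℕ-multiple i = toℕ-fromℕ< _

  toℕ-multiple-injective : ∀ {i j} → toℕ (multiple i) ≡ toℕ (multiple j) → i ≡ j
  toℕ-multiple-injective {i} {j} eq =
    toℕ-injective (*-cancelʳ-≡ _ _ M (trans (sym (toℕ-multiple i)) (trans eq (toℕ-multiple j))))

  multiple-injective : Injective _≡_ _≡_ multiple
  multiple-injective = toℕ-multiple-injective ∘ cong toℕ

  multiple-%-pM : ∀ i → toℕ (multiple i) % (p * M) ≡ toℕ (multiple i)
  multiple-%-pM i = m<n⇒m%n≡m (subst (_< p * M) (sym (toℕ-multiple i)) (iM<pM i))

  multiple-%-M : ∀ i → toℕ (multiple i) % M ≡ 0
  multiple-%-M i = trans (cong (_% M) (toℕ-multiple i)) (m*n%n≡0 (toℕ i) M)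

  M∣n : M ∣ n
  M∣n = subst (M ∣_) (sym n≡p²M) (n∣m*n (p * p))

  pM∣n : p * M ∣ n
  pM∣n = subst (p * M ∣_) (sym n≡p*pM) (n∣m*n p)

  multiple-⊖-hasOrder : ∀ {i j} → i ≢ j → HasOrder n (multiple i ⊖ multiple j) (p * p)
  multiple-⊖-hasOrder {i} {j} i≢j = hasOrder-p²⇐ pp n≡p²M _ M∣⊖ pM∤⊖
    where
    open ≡-Reasoning
    M∣⊖ : M ∣ toℕ (multiple i ⊖ multiple j)
    M∣⊖ = from (∣⊖⇔%≡ M∣n _ _) (trans (multiple-%-M i) (sym (multiple-%-M j)))
    pM∤⊖ : ¬ p * M ∣ toℕ (multiple i ⊖ multiple j)
    pM∤⊖ pM∣⊖ = i≢j (toℕ-multiple-injective (begin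
      toℕ (multiple i)           ≡⟨ multiple-%-pM i ⟨
      toℕ (multiple i) % (p * M) ≡⟨ to (∣⊖⇔%≡ pM∣n _ _) pM∣⊖ ⟩
      toℕ (multiple j) % (p * M) ≡⟨ multiple-%-pM j ⟩
      toℕ (multiple j)           ∎))

DiffersExactlyAt : {I X B : Set} → (I → X → B) → I → X → X → Set
DiffersExactlyAt R c x y = R c x ≢ R c y × (∀ d → d ≢ c → R d x ≡ R d y)

differsExactlyAt-unique : ∀ {I X B : Set} → DecidableEquality I → {R : I → X → B} {c e : I} {x y : X} →
                          DiffersExactlyAt R e x y → R c x ≢ R c y → e ≡ c
differsExactlyAt-unique _≟_ {c = c} {e} (_ , agree) c-differs with e ≟ c
... | yes e≡c = e≡c
... | no e≢c = ⊥-elim (c-differs (agree c (e≢c ∘ sym)))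

module HammingClique {I J X B : Set} (_≟ᴵ_ : DecidableEquality I) (_≟ᴶ_ : DecidableEquality J)
  (R : I → X → B) (f : J → X) (adjacent : ∀ i j → i ≢ j → ∃[ c ] DiffersExactlyAt R c (f i) (f j))
  {i₀ i₁ : J} {c : I} (i₀i₁-differ : DiffersExactlyAt R c (f i₀) (f i₁)) where

  -- A vertex leaving the line in a direction e ≢ c would differ from f i₁ in both c and e.
  direction : ∀ {i e} → DiffersExactlyAt R e (f i) (f i₀) → e ≡ c
  direction {i} {e} (e-differs , e-agree) with e ≟ᴵ c
  ... | yes e≡c = e≡c
  ... | no e≢c = ⊥-elim (e-differs (begin
      R e (f i)  ≡⟨ proj₂ i-vs-i₁ e (λ e≡e′ → e≢c (trans e≡e′ e′≡c)) ⟩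
      R e (f i₁) ≡⟨ proj₂ i₀i₁-differ e e≢c ⟨
      R e (f i₀) ∎))
    where
    open ≡-Reasoning
    c-agree : R c (f i) ≡ R c (f i₀)
    c-agree = e-agree c (e≢c ∘ sym)
    c-differs : R c (f i) ≢ R c (f i₁)
    c-differs = proj₁ i₀i₁-differ ∘ trans (sym c-agree)
    i≢i₁ : i ≢ i₁
    i≢i₁ refl = c-differs refl
    e′ : I
    e′ = proj₁ (adjacent i i₁ i≢i₁)
    i-vs-i₁ : DiffersExactlyAt R e′ (f i) (f i₁)
    i-vs-i₁ = proj₂ (adjacent i i₁ i≢i₁)
    e′≡c : e′ ≡ c
    e′≡c = differsExactlyAt-unique _≟ᴵ_ {R = R} i-vs-i₁ c-differs

  agree-off-line : ∀ i d → d ≢ c → R d (f i) ≡ R d (f i₀)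
  agree-off-line i d d≢c with i ≟ᴶ i₀
  ... | yes refl = refl
  ... | no i≢i₀ with adjacent i i₀ i≢i₀
  ... | e , i-vs-i₀ = proj₂ i-vs-i₀ d (λ d≡e → d≢c (trans d≡e (direction i-vs-i₀)))

  line-injective : Injective _≡_ _≡_ (R c ∘ f)
  line-injective {i} {j} c-agree with i ≟ᴶ j
  ... | yes i≡j = i≡j
  ... | no i≢j with adjacent i j i≢j
  ... | e , e-differs , _ = ⊥-elim (e-differs (trans (agree-off-line i e e≢c) (sym (agree-off-line j e e≢c))))
    where
    e≢c : e ≢ c
    e≢c refl = e-differs c-agree

module ThreeSquares {α β γ : ℕ} (pα : Prime α) (pβ : Prime β) (pγ : Prime γ) (α<β : α < β) (β<γ : β < γ)
                    {n : ℕ} .{{_ : NonZero n}} (n≡ : n ≡ (α * α) * (β * β) * (γ * γ)) where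

  prime : Fin 3 → ℕ
  prime zero             = α
  prime (suc zero)       = β
  prime (suc (suc zero)) = γ

  prime-isPrime : ∀ c → Prime (prime c)
  prime-isPrime zero             = pα
  prime-isPrime (suc zero)       = pβ
  prime-isPrime (suc (suc zero)) = pγ

  prime≤γ : ∀ c → prime c ≤ γ
  prime≤γ zero             = <⇒≤ (<-trans α<β β<γ)
  prime≤γ (suc zero)       = <⇒≤ β<γ
  prime≤γ (suc (suc zero)) = ≤-refl

  instance
    prime≢0 : ∀ {c} → NonZero (prime c)
    prime≢0 {c} = prime⇒nonZero (prime-isPrime c)

  cofactor : Fin 3 → ℕ
  cofactor zero             = β * β * (γ * γ)
  cofactor (suc zero)       = α * α * (γ * γ)
  cofactor (suc (suc zero)) = α * α * (β * β)

  n≡prime²*cofactor : ∀ c → n ≡ prime c * prime c * cofactor c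
  n≡prime²*cofactor zero             = trans n≡ (*-assoc (α * α) (β * β) (γ * γ))
  n≡prime²*cofactor (suc zero)       = trans n≡ (xy∙z≈y∙xz (α * α) (β * β) (γ * γ))
  n≡prime²*cofactor (suc (suc zero)) = trans n≡ (*-comm (α * α * (β * β)) (γ * γ))

  α≢β : α ≢ β
  α≢β = <⇒≢ α<β

  β≢γ : β ≢ γ
  β≢γ = <⇒≢ β<γ

  α≢γ : α ≢ γ
  α≢γ = <⇒≢ (<-trans α<β β<γ)

  prime∤cofactor : ∀ c → ¬ prime c ∣ cofactor c
  prime∤cofactor zero             = prime∤q²r² pα (prime∤prime pα pβ α≢β) (prime∤prime pα pγ α≢γ)
  prime∤cofactor (suc zero)       = prime∤q²r² pβ (prime∤prime pβ pα (≢-sym α≢β)) (prime∤prime pβ pγ β≢γ)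
  prime∤cofactor (suc (suc zero)) = prime∤q²r² pγ (prime∤prime pγ pα (≢-sym α≢γ)) (prime∤prime pγ pβ (≢-sym β≢γ))

  prime∣cofactor : ∀ c d → d ≢ c → prime d ∣ cofactor c
  prime∣cofactor zero             zero             d≢c = ⊥-elim (d≢c refl)
  prime∣cofactor zero             (suc zero)       _   = q∣q²r² β γ
  prime∣cofactor zero             (suc (suc zero)) _   = r∣q²r² β γ
  prime∣cofactor (suc zero)       zero             _   = q∣q²r² α γ
  prime∣cofactor (suc zero)       (suc zero)       d≢c = ⊥-elim (d≢c refl)
  prime∣cofactor (suc zero)       (suc (suc zero)) _   = r∣q²r² α γ
  prime∣cofactor (suc (suc zero)) zero             _   = q∣q²r² α β
  prime∣cofactor (suc (suc zero)) (suc zero)       _   = r∣q²r² α β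
  prime∣cofactor (suc (suc zero)) (suc (suc zero)) d≢c = ⊥-elim (d≢c refl)

  prime∣n : ∀ c → prime c ∣ n
  prime∣n c = subst (prime c ∣_) (sym (n≡prime²*cofactor c)) (∣-trans (m∣m*n (prime c)) (m∣m*n (cofactor c)))

  inC⇒hasOrder-prime² : ∀ {x} → InC n α β γ x → ∃[ c ] HasOrder n x (prime c * prime c)
  inC⇒hasOrder-prime² (inj₁ order)        = zero , order
  inC⇒hasOrder-prime² (inj₂ (inj₁ order)) = suc zero , order
  inC⇒hasOrder-prime² (inj₂ (inj₂ order)) = suc (suc zero) , order

  residue : Fin 3 → Fin n → ℕ
  residue c x = toℕ x % prime c

  adjacent⇒differsExactlyAt : ∀ {x y} → Adj n α β γ x y → ∃[ c ] DiffersExactlyAt residue c x y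
  adjacent⇒differsExactlyAt {x} {y} (_ , inC) with inC⇒hasOrder-prime² inC
  ... | c , order with hasOrder-p²⇒∤ (prime-isPrime c) (prime∤cofactor c) (n≡prime²*cofactor c) (x ⊖ y) order
  ... | cofactor∣⊖ , prime∤⊖ = c , prime∤⊖ ∘ from (∣⊖⇔%≡ (prime∣n c) x y) ,
        λ d d≢c → to (∣⊖⇔%≡ (prime∣n d) x y) (∣-trans (prime∣cofactor c d d≢c) cofactor∣⊖)

  clique-size≤γ : ∀ k (f : Fin k → Fin n) → IsClique n α β γ k f → k ≤ γ
  clique-size≤γ zero                _ _              = z≤n
  clique-size≤γ (suc zero)          _ _              = <⇒≤ (prime⇒1<p pγ)
  clique-size≤γ (suc (suc k)) f (_ , adjacent) =
    let c , line = hamming zero (suc zero) (λ ())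
    in ≤-trans (%-injective⇒≤ (prime c) (toℕ ∘ f) (line-injective hamming line)) (prime≤γ c)
    where
    open HammingClique Fin._≟_ Fin._≟_ residue f
    hamming : ∀ i j → i ≢ j → ∃[ c ] DiffersExactlyAt residue c (f i) (f j)
    hamming i j i≢j = adjacent⇒differsExactlyAt (adjacent i j i≢j)

  clique-of-size-γ : Σ (Fin γ → Fin n) (IsClique n α β γ γ)
  clique-of-size-γ = multiple , multiple-injective ,
    λ i j i≢j → i≢j ∘ multiple-injective , inj₂ (inj₂ (multiple-⊖-hasOrder i≢j))
    where
    open Multiples {{m*n≢0 (α * α) (β * β) {{m*n≢0 α α}} {{m*n≢0 β β}}}} pγ (n≡prime²*cofactor (suc (suc zero)))

proposition2p7 : (α β γ : ℕ) → Prime α → Prime β → Prime γ → α < β → β < γ →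
    (n : ℕ) .{{_ : NonZero n}} → n ≡ (α * α) * (β * β) * (γ * γ) →
    CliqueNumberIs n α β γ γ
proposition2p7 α β γ pα pβ pγ α<β β<γ n n≡ = clique-of-size-γ , clique-size≤γ
  where open ThreeSquares pα pβ pγ α<β β<γ n≡
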